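{- Let $\beta\in\mathfrak S_n$ and $k\ge1$. The saillance codes of the elements of $\operatorname{id}_k\Cup\beta$ are exactly the sequences $$(\tau_S(\beta)(i_1),\tau_S(\beta)(i_2),\ldots,\tau_S(\beta)(i_k),\operatorname{Sc}(\beta)),$$ where $(i_1,\ldots,i_k)$ runs over the nondecreasing sequences $0\le i_1\le\cdots\le i_k\le n$. In particular $$\sum_{\sigma\in\operatorname{id}_k\Cup\beta} x_{\operatorname{Sc}(\sigma)}=h_k(X_n)\,x_{\operatorname{Sc}(\beta)}.$$
   Context: Permutations are words. $\operatorname{id}_k\Cup\beta$ is the set of permutations of $[n+k]$ obtained by shuffling the word $12\cdots k$ with the word $(\beta(1)+k)(\beta(2)+k)\cdots(\beta(n)+k)$. $\tau_S(\beta)$ is the permutation of $\{0,\ldots,n\}$ with $\tau_S(\beta)(0)=0$ and $\tau_S(\beta)(i)=n+1-\beta(i)$ for $1\le i\le n$. Saillance code: for $\sigma\in\mathfrak S_m$, $\operatorname{Sc}(\sigma)=(a_1,\ldots,a_m)$ where, if some letter greater than $j$ lies to the left of $j$ in $\sigma$ and $b$ is the rightmost such letter, $a_j=m+1-b$; otherwise $a_j=0$. $x_0,x_1,\ldots$ are commuting indeterminates, $x_c=x_{c_1}\cdots x_{c_m}$, $X_n=\{x_0,\ldots,x_n\}$, and $h_k(X_n)$ is the complete homogeneous symmetric polynomial of degree $k$ in $x_0,\ldots,x_n$. -}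

module Defs where

open import Data.Nat using (ℕ; zero; suc; _+_; _∸_; _<?_; _≤_)
open import Data.List using (List; []; _∷_; map; concatMap; upTo; filter; length; _++_; foldr)
open import Data.Maybe using (Maybe; just; nothing)
open import Data.Nat using (_≟_)
open import Relation.Nullary using (yes; no)
open import Level using (Level)
open import Algebra.Bundles using (CommutativeSemiring)

-- Words / permutations are lists of natural numbers.

range : ℕ → ℕ → List ℕ
range a b = map (a +_) (upTo (suc b ∸ a))

idWord : ℕ → List ℕ
idWord n = range 1 n

-- all shuffles of two words (as a list; for words with disjoint letters the
-- entries are pairwise distinct)
shuffles : List ℕ → List ℕ → List (List ℕ)
shuffles [] ys = ys ∷ []
shuffles (x ∷ xs) [] = (x ∷ xs) ∷ []
shuffles (x ∷ xs) (y ∷ ys) =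
  map (x ∷_) (shuffles xs (y ∷ ys)) ++ map (y ∷_) (shuffles (x ∷ xs) ys)

idShuffle : ℕ → List ℕ → List (List ℕ)
idShuffle k β = shuffles (idWord k) (map (_+ k) β)

leftOf : ℕ → List ℕ → List ℕ
leftOf j [] = []
leftOf j (x ∷ xs) with x ≟ j
... | yes _ = []
... | no _  = x ∷ leftOf j xs

lastM : List ℕ → Maybe ℕ
lastM [] = nothing
lastM (x ∷ []) = just x
lastM (x ∷ y ∷ ys) = lastM (y ∷ ys)

scEntry : ℕ → List ℕ → ℕ → ℕ
scEntry m σ j with lastM (filter (j <?_) (leftOf j σ))
... | nothing = 0
... | just b  = suc m ∸ b

Sc : List ℕ → List ℕ
Sc σ = map (scEntry (length σ) σ) (idWord (length σ))

-- w(i) for 1-indexed position i (0 outside the range)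
at : List ℕ → ℕ → ℕ
at [] i = 0
at (x ∷ xs) zero = 0
at (x ∷ xs) (suc zero) = x
at (x ∷ xs) (suc (suc i)) = at xs (suc i)

tauS : List ℕ → ℕ → ℕ
tauS β zero = 0
tauS β (suc i) = suc (length β) ∸ at β (suc i)

ndSeqs : ℕ → ℕ → ℕ → List (List ℕ)
ndSeqs zero lo n = [] ∷ []
ndSeqs (suc k) lo n = concatMap (λ i → map (i ∷_) (ndSeqs k i n)) (range lo n)

module _ {c ℓ : Level} (R : CommutativeSemiring c ℓ) where
  open CommutativeSemiring R using (Carrier; 0#; 1#) renaming (_+_ to _⊕_; _*_ to _⊛_)

  sumR : List Carrier → Carrier
  sumR = foldr _⊕_ 0#

  prodR : List Carrier → Carrier
  prodR = foldr _⊛_ 1#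

  monomial : (ℕ → Carrier) → List ℕ → Carrier
  monomial x cs = prodR (map x cs)

  hComplete : ℕ → ℕ → (ℕ → Carrier) → Carrier
  hComplete k n x = sumR (map (monomial x) (ndSeqs k 0 n))

-- Put σ ∈ id_k ⋓ β and m = k + n. The letters k+1, …, k+n of σ form the word β shifted
-- by k, and the small letters 1, …, k never matter when a letter larger than k looks to
-- its left; so the last n entries of Sc(σ) are Sc(β). For j ≤ k every larger letter is
-- a shifted β-letter, so if p ≥ 1 β-letters precede j, the rightmost larger letter to
-- the left of j is β(p) + k and a_j = m + 1 − (β(p) + k) = τ_S(β)(p); if p = 0 then
-- a_j = 0 = τ_S(β)(0). As j runs through 1, …, k these positions p form a nondecreasing
-- sequence, and every such sequence arises from exactly one shuffle: listing the
-- shuffles in their natural order lists these sequences as the multisets of size k on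
-- 0, …, n. Summing monomials then gives h_k(x_{τ(0)}, …, x_{τ(n)}) x_{Sc(β)}, and
-- τ_S(β) permutes {0, …, n}, which leaves h_k unchanged.
module Submission where

open import Defs
open import Level using (Level)
open import Function using (_∘_)
open import Data.Empty using (⊥-elim)
open import Data.Maybe using (Maybe; just; nothing)
import Data.Maybe as Maybe
open import Data.Product using (_×_; _,_; ∃-syntax)
open import Data.Sum using (inj₁; inj₂)
open import Data.Nat using (ℕ; zero; suc; _≤_; _<_; _+_; _∸_; z≤n; s≤s; _<?_; _≟_)
open import Data.Nat.Properties
  using (≤-refl; ≤-trans; ≤-<-trans; ≮⇒≥; <-cmp; ≤-pred; <⇒≤; ≤⇒≯; <⇒≢; m<m+n; m≤m+n; 1+n≰n;
         m≤n⇒m<n∨m≡n;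
         +-suc; +-comm; +-identityʳ; +-monoˡ-<; suc-injective; m+n∸m≡n; [m+n]∸[m+o]≡n∸o)
open import Data.List using (List; []; _∷_; map; concatMap; length; upTo; downFrom; applyUpTo; _++_; filter; reverse)
open import Data.List.Properties
  using (map-++; map-∘; map-cong; map-cong-local; map-upTo; length-map; length-upTo;
         ++-identityʳ; filter-accept; filter-reject; filter-all; filter-none; reverse-downFrom)
open import Data.List.Relation.Unary.All using (All; []; _∷_)
import Data.List.Relation.Unary.All as All
import Data.List.Relation.Unary.All.Properties as All
open import Data.List.Relation.Unary.AllPairs using (AllPairs; []; _∷_)
open import Data.List.Relation.Unary.Linked using (Linked; []; [-]; _∷_)
import Data.List.Relation.Unary.Linked as Linked
open import Data.List.Relation.Unary.Linked.Properties using (Linked⇒All)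
open import Data.List.Relation.Unary.Any using (here)
open import Data.List.Membership.Propositional using (_∈_)
open import Data.List.Membership.Propositional.Properties using (∈-map⁺; ∈-map⁻; ∈-++⁺ˡ; ∈-++⁺ʳ; ∈-++⁻)
open import Data.List.Relation.Binary.Permutation.Propositional
  using (_↭_; prep; ↭-sym; module PermutationReasoning)
open import Data.List.Relation.Binary.Permutation.Propositional.Properties
  using (map⁺; ↭-reverse; ↭-length; All-resp-↭)
import Data.List.Relation.Binary.Permutation.Propositional as Perm
open import Relation.Nullary using (yes; no; ¬_; contradiction)
open import Relation.Binary using (tri<; tri≈; tri>)
open import Relation.Unary using (Pred; Decidable)
open import Relation.Binary.PropositionalEquality
  using (_≡_; refl; sym; trans; cong; cong₂; subst; module ≡-Reasoning)
open import Algebra.Bundles using (CommutativeSemiring)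
import Algebra.Solver.Ring.NaturalCoefficients.Default as Solver

upFrom : ℕ → ℕ → List ℕ
upFrom a zero    = []
upFrom a (suc c) = a ∷ upFrom (suc a) c

applyUpTo≡upFrom : ∀ (f : ℕ → ℕ) a c → (∀ i → f i ≡ a + i) → applyUpTo f c ≡ upFrom a c
applyUpTo≡upFrom f a zero    f≗a+ = refl
applyUpTo≡upFrom f a (suc c) f≗a+ =
  cong₂ _∷_ (trans (f≗a+ 0) (+-identityʳ a))
            (applyUpTo≡upFrom (f ∘ suc) (suc a) c (λ i → trans (f≗a+ (suc i)) (+-suc a i)))

range≡upFrom : ∀ a b → range a b ≡ upFrom a (suc b ∸ a)
range≡upFrom a b =
  trans (map-upTo (a +_) (suc b ∸ a)) (applyUpTo≡upFrom (a +_) a (suc b ∸ a) (λ _ → refl))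

idWord≡upFrom : ∀ n → idWord n ≡ upFrom 1 n
idWord≡upFrom n = range≡upFrom 1 n

length-idWord : ∀ n → length (idWord n) ≡ n
length-idWord n = trans (length-map (1 +_) (upTo n)) (length-upTo n)

upFrom-+ : ∀ a c d → upFrom a (c + d) ≡ upFrom a c ++ upFrom (a + c) d
upFrom-+ a zero    d = cong (λ b → upFrom b d) (sym (+-identityʳ a))
upFrom-+ a (suc c) d =
  cong (a ∷_) (trans (upFrom-+ (suc a) c d) (cong (λ b → upFrom (suc a) c ++ upFrom b d) (sym (+-suc a c))))

map-+-upFrom : ∀ k a c → map (_+ k) (upFrom a c) ≡ upFrom (a + k) c
map-+-upFrom k a zero    = refl
map-+-upFrom k a (suc c) = cong (a + k ∷_) (map-+-upFrom k (suc a) c)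

map-suc-upFrom : ∀ a c → map suc (upFrom a c) ≡ upFrom (suc a) c
map-suc-upFrom a zero    = refl
map-suc-upFrom a (suc c) = cong (suc a ∷_) (map-suc-upFrom (suc a) c)

upFrom-lowerBound : ∀ a c → All (a ≤_) (upFrom a c)
upFrom-lowerBound a zero    = []
upFrom-lowerBound a (suc c) = ≤-refl ∷ All.map <⇒≤ (upFrom-lowerBound (suc a) c)

upFrom-upperBound : ∀ a c → All (_< a + c) (upFrom a c)
upFrom-upperBound a zero    = []
upFrom-upperBound a (suc c) =
  subst (λ b → All (_< b) (a ∷ upFrom (suc a) c)) (sym (+-suc a c))
        (s≤s (m≤m+n a c) ∷ upFrom-upperBound (suc a) c)

upFrom-increasing : ∀ a c → AllPairs _<_ (upFrom a c)
upFrom-increasing a zero    = []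
upFrom-increasing a (suc c) = upFrom-lowerBound (suc a) c ∷ upFrom-increasing (suc a) c

idWord-+ : ∀ k n → idWord (k + n) ≡ idWord k ++ map (_+ k) (idWord n)
idWord-+ k n = begin
  idWord (k + n)                          ≡⟨ idWord≡upFrom (k + n) ⟩
  upFrom 1 (k + n)                        ≡⟨ upFrom-+ 1 k n ⟩
  upFrom 1 k ++ upFrom (1 + k) n          ≡⟨ cong₂ _++_ (sym (idWord≡upFrom k)) (sym (map-+-upFrom k 1 n)) ⟩
  idWord k ++ map (_+ k) (upFrom 1 n)     ≡⟨ cong (λ w → idWord k ++ map (_+ k) w) (sym (idWord≡upFrom n)) ⟩
  idWord k ++ map (_+ k) (idWord n)       ∎
  where open ≡-Reasoning

idWord-positive : ∀ n → All (1 ≤_) (idWord n)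
idWord-positive n = subst (All (1 ≤_)) (sym (idWord≡upFrom n)) (upFrom-lowerBound 1 n)

idWord-bounded : ∀ n → All (_≤ n) (idWord n)
idWord-bounded n = subst (All (_≤ n)) (sym (idWord≡upFrom n)) (All.map ≤-pred (upFrom-upperBound 1 n))

idWord-increasing : ∀ n → AllPairs _<_ (idWord n)
idWord-increasing n = subst (AllPairs _<_) (sym (idWord≡upFrom n)) (upFrom-increasing 1 n)

↭idWord-positive : ∀ {n β} → β ↭ idWord n → All (1 ≤_) β
↭idWord-positive {n} β↭ = All-resp-↭ (↭-sym β↭) (idWord-positive n)

module _ {a} {A : Set a} where

  multichoose : ℕ → List A → List (List A)
  multichoose zero    xs       = [] ∷ []
  multichoose (suc c) []       = []
  multichoose (suc c) (x ∷ xs) = map (x ∷_) (multichoose c (x ∷ xs)) ++ multichoose (suc c) xs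

module _ {a b} {A : Set a} {B : Set b} where

  map-multichoose : ∀ (f : A → B) c xs → map (map f) (multichoose c xs) ≡ multichoose c (map f xs)
  map-multichoose f zero    xs       = refl
  map-multichoose f (suc c) []       = refl
  map-multichoose f (suc c) (x ∷ xs) = begin
    map (map f) (map (x ∷_) M₁ ++ M₂)
      ≡⟨ map-++ (map f) (map (x ∷_) M₁) M₂ ⟩
    map (map f) (map (x ∷_) M₁) ++ map (map f) M₂
      ≡⟨ cong (_++ map (map f) M₂) (trans (sym (map-∘ {g = map f} {f = x ∷_} M₁)) (map-∘ M₁)) ⟩
    map (f x ∷_) (map (map f) M₁) ++ map (map f) M₂
      ≡⟨ cong₂ (λ l r → map (f x ∷_) l ++ r) (map-multichoose f c (x ∷ xs)) (map-multichoose f (suc c) xs) ⟩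
    multichoose (suc c) (map f (x ∷ xs))
      ∎
    where
    open ≡-Reasoning
    M₁ = multichoose c (x ∷ xs)
    M₂ = multichoose (suc c) xs

Linked-∷ : ∀ {p js} → All (p ≤_) js → Linked _≤_ js → Linked _≤_ (p ∷ js)
Linked-∷ []        _      = [-]
Linked-∷ (p≤j ∷ _) sorted = p≤j ∷ sorted

module _ {n : ℕ} where

  ndSeqs≡multichoose : ∀ c p r → p + r ≡ suc n → ndSeqs c p n ≡ multichoose c (upFrom p r)
  ndSeqs≡multichoose zero    p r p+r≡ = refl
  ndSeqs≡multichoose (suc c) p r p+r≡ =
    trans (cong (concatMap extend) range≡) (concatMap≡ p r p+r≡)
    where
    extend : ℕ → List (List ℕ)
    extend i = map (i ∷_) (ndSeqs c i n)
    range≡ : range p n ≡ upFrom p r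
    range≡ = trans (range≡upFrom p n) (cong (upFrom p) (trans (cong (_∸ p) (sym p+r≡)) (m+n∸m≡n p r)))
    concatMap≡ : ∀ p r → p + r ≡ suc n → concatMap extend (upFrom p r) ≡ multichoose (suc c) (upFrom p r)
    concatMap≡ p zero    _    = refl
    concatMap≡ p (suc r) p+r≡ =
      cong₂ _++_ (cong (map (p ∷_)) (ndSeqs≡multichoose c p (suc r) p+r≡))
                 (concatMap≡ (suc p) r (trans (sym (+-suc p r)) p+r≡))

  ∈-multichoose-upFrom⁻ : ∀ c p r → p + r ≡ suc n → ∀ {is} → is ∈ multichoose c (upFrom p r) →
                          length is ≡ c × Linked _≤_ is × All (_≤ n) is × All (p ≤_) is
  ∈-multichoose-upFrom⁻ zero    p r       _    (here refl) = refl , [] , [] , []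
  ∈-multichoose-upFrom⁻ (suc c) p zero    _    ()
  ∈-multichoose-upFrom⁻ (suc c) p (suc r) p+r≡ {is} is∈
    with ∈-++⁻ (map (p ∷_) (multichoose c (upFrom p (suc r)))) is∈
  ... | inj₁ is∈₁ with ∈-map⁻ (p ∷_) is∈₁
  ...   | js , js∈ , refl with ∈-multichoose-upFrom⁻ c p (suc r) p+r≡ js∈
  ...     | len , sorted , ≤n , p≤ =
    cong suc len , Linked-∷ p≤ sorted , ≤-pred (subst (p <_) p+r≡ (m<m+n p (s≤s z≤n))) ∷ ≤n , ≤-refl ∷ p≤
  ∈-multichoose-upFrom⁻ (suc c) p (suc r) p+r≡ is∈ | inj₂ is∈₂
    with ∈-multichoose-upFrom⁻ (suc c) (suc p) r (trans (sym (+-suc p r)) p+r≡) is∈₂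
  ... | len , sorted , ≤n , p<  = len , sorted , ≤n , All.map <⇒≤ p<

  ∈-multichoose-upFrom⁺ : ∀ c p r → p + r ≡ suc n → ∀ is → length is ≡ c → Linked _≤_ is →
                          All (_≤ n) is → All (p ≤_) is → is ∈ multichoose c (upFrom p r)
  ∈-multichoose-upFrom⁺ zero    p r       _    []       _   _      _             _ = here refl
  ∈-multichoose-upFrom⁺ (suc c) p zero    p+0≡ (i ∷ js) _   _      (i≤n ∷ _)     (p≤i ∷ _) =
    ⊥-elim (1+n≰n (subst (_≤ _) (trans (sym (+-identityʳ p)) p+0≡) (≤-trans p≤i i≤n)))
  ∈-multichoose-upFrom⁺ (suc c) p (suc r) p+r≡ (i ∷ js) len sorted (i≤n ∷ ≤n) (p≤i ∷ p≤)
    with m≤n⇒m<n∨m≡n p≤i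
  ... | inj₂ refl = ∈-++⁺ˡ (∈-map⁺ (p ∷_)
        (∈-multichoose-upFrom⁺ c p (suc r) p+r≡ js (suc-injective len) (Linked.tail sorted) ≤n p≤))
  ... | inj₁ p<i  = ∈-++⁺ʳ (map (p ∷_) (multichoose c (upFrom p (suc r))))
        (∈-multichoose-upFrom⁺ (suc c) (suc p) r (trans (sym (+-suc p r)) p+r≡) (i ∷ js) len sorted
           (i≤n ∷ ≤n) (Linked⇒All ≤-trans p<i sorted))

length-shuffles : ∀ xs ys → All (λ σ → length σ ≡ length xs + length ys) (shuffles xs ys)
length-shuffles []       ys       = refl ∷ []
length-shuffles (x ∷ xs) []       = sym (+-identityʳ (length (x ∷ xs))) ∷ []
length-shuffles (x ∷ xs) (y ∷ ys) =
  All.++⁺ (All.map⁺ (All.map (cong suc) (length-shuffles xs (y ∷ ys))))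
          (All.map⁺ (All.map (λ len → trans (cong suc len) (sym (+-suc (length (x ∷ xs)) (length ys))))
                             (length-shuffles (x ∷ xs) ys)))

filter-shuffles : ∀ {p} {P : Pred ℕ p} (P? : Decidable P) xs ys → All (¬_ ∘ P) xs → All P ys →
                  All (λ σ → filter P? σ ≡ ys) (shuffles xs ys)
filter-shuffles P? []       ys       _            Pys        = filter-all P? Pys ∷ []
filter-shuffles P? (x ∷ xs) []       ¬Pxs         []         = filter-none P? ¬Pxs ∷ []
filter-shuffles P? (x ∷ xs) (y ∷ ys) (¬Px ∷ ¬Pxs) (Py ∷ Pys) =
  All.++⁺ (All.map⁺ (All.map (trans (filter-reject P? ¬Px)) (filter-shuffles P? xs (y ∷ ys) ¬Pxs (Py ∷ Pys))))
          (All.map⁺ (All.map (λ eq → trans (filter-accept P? Py) (cong (y ∷_) eq))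
                             (filter-shuffles P? (x ∷ xs) ys (¬Px ∷ ¬Pxs) Pys)))

greaterBefore : ℕ → List ℕ → List ℕ
greaterBefore j σ = filter (j <?_) (leftOf j σ)

lastOr : Maybe ℕ → List ℕ → Maybe ℕ
lastOr d []       = d
lastOr d (x ∷ xs) = lastOr (just x) xs

lastM≡lastOr : ∀ xs → lastM xs ≡ lastOr nothing xs
lastM≡lastOr []           = refl
lastM≡lastOr (x ∷ [])     = refl
lastM≡lastOr (x ∷ y ∷ ys) = lastM≡lastOr (y ∷ ys)

lastM-map : ∀ (f : ℕ → ℕ) xs → lastM (map f xs) ≡ Maybe.map f (lastM xs)
lastM-map f []           = refl
lastM-map f (x ∷ [])     = refl
lastM-map f (x ∷ y ∷ ys) = lastM-map f (y ∷ ys)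

-- The letter that a_j is read off from: the rightmost letter larger than j to the left
-- of j in σ, or d when there is none.
salient : Maybe ℕ → List ℕ → ℕ → Maybe ℕ
salient d σ j = lastOr d (greaterBefore j σ)

greaterBefore-self : ∀ x σ → greaterBefore x (x ∷ σ) ≡ []
greaterBefore-self x σ with x ≟ x
... | yes _   = refl
... | no x≢x = contradiction refl x≢x

greaterBefore-smaller : ∀ {x j} σ → x < j → greaterBefore j (x ∷ σ) ≡ greaterBefore j σ
greaterBefore-smaller {x} {j} σ x<j with x ≟ j
... | yes x≡j = contradiction x≡j (<⇒≢ x<j)
... | no _    = filter-reject (j <?_) (≤⇒≯ (<⇒≤ x<j))

greaterBefore-larger : ∀ {y j} σ → j < y → greaterBefore j (y ∷ σ) ≡ y ∷ greaterBefore j σ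
greaterBefore-larger {y} {j} σ j<y with y ≟ j
... | yes y≡j = contradiction (sym y≡j) (<⇒≢ j<y)
... | no _    = filter-accept (j <?_) j<y

salients-∷ : ∀ d {x L} → All (x <_) L → ∀ σ → map (salient d (x ∷ σ)) (x ∷ L) ≡ d ∷ map (salient d σ) L
salients-∷ d {x} x<L σ =
  cong₂ _∷_ (cong (lastOr d) (greaterBefore-self x σ))
            (map-cong-local (All.map (cong (lastOr d) ∘ greaterBefore-smaller σ) x<L))

salients-shuffles : ∀ d L ys → AllPairs _<_ L → All (λ y → All (_< y) L) ys →
                    map (λ σ → map (salient d σ) L) (shuffles L ys) ≡ multichoose (length L) (d ∷ map just ys)
salients-shuffles d []       ys       _              _           = refl
salients-shuffles d (x ∷ xs) []       (x<xs ∷ xs↑)   []          = begin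
  map (salient d (x ∷ xs)) (x ∷ xs) ∷ []
    ≡⟨ cong (_∷ []) (salients-∷ d x<xs xs) ⟩
  map (d ∷_) (map (λ σ → map (salient d σ) xs) (xs ∷ []))
    ≡⟨ cong (map (d ∷_)) (trans (cong (map _) (sym (shuffles-[] xs))) (salients-shuffles d xs [] xs↑ [])) ⟩
  map (d ∷_) (multichoose (length xs) (d ∷ []))
    ≡⟨ sym (++-identityʳ _) ⟩
  multichoose (length (x ∷ xs)) (d ∷ [])
    ∎
  where
  open ≡-Reasoning
  shuffles-[] : ∀ xs → shuffles xs [] ≡ xs ∷ []
  shuffles-[] []      = refl
  shuffles-[] (_ ∷ _) = refl
salients-shuffles d (x ∷ xs) (y ∷ ys) (x<xs ∷ xs↑)   (L<y ∷ L<ys) = begin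
  map F (map (x ∷_) S₁ ++ map (y ∷_) S₂)
    ≡⟨ map-++ F (map (x ∷_) S₁) (map (y ∷_) S₂) ⟩
  map F (map (x ∷_) S₁) ++ map F (map (y ∷_) S₂)
    ≡⟨ cong₂ _++_ (sym (map-∘ S₁)) (sym (map-∘ S₂)) ⟩
  map (F ∘ (x ∷_)) S₁ ++ map (F ∘ (y ∷_)) S₂
    ≡⟨ cong₂ _++_ (map-cong (salients-∷ d x<xs) S₁) (map-cong (λ σ → salients-larger σ L<y) S₂) ⟩
  map ((d ∷_) ∘ F₁) S₁ ++ map F₂ S₂
    ≡⟨ cong (_++ map F₂ S₂) (map-∘ S₁) ⟩
  map (d ∷_) (map F₁ S₁) ++ map F₂ S₂
    ≡⟨ cong₂ (λ l r → map (d ∷_) l ++ r)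
             (salients-shuffles d xs (y ∷ ys) xs↑ (All.tail L<y ∷ All.map All.tail L<ys))
             (salients-shuffles (just y) (x ∷ xs) ys (x<xs ∷ xs↑) L<ys) ⟩
  multichoose (length (x ∷ xs)) (d ∷ map just (y ∷ ys))
    ∎
  where
  open ≡-Reasoning
  S₁ = shuffles xs (y ∷ ys)
  S₂ = shuffles (x ∷ xs) ys
  F : List ℕ → List (Maybe ℕ)
  F σ = map (salient d σ) (x ∷ xs)
  F₁ : List ℕ → List (Maybe ℕ)
  F₁ σ = map (salient d σ) xs
  F₂ : List ℕ → List (Maybe ℕ)
  F₂ σ = map (salient (just y) σ) (x ∷ xs)
  salients-larger : ∀ σ → All (_< y) (x ∷ xs) → map (salient d (y ∷ σ)) (x ∷ xs) ≡ F₂ σ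
  salients-larger σ L<y = map-cong-local (All.map (cong (lastOr d) ∘ greaterBefore-larger σ) L<y)

codeLetter : ℕ → Maybe ℕ → ℕ
codeLetter m nothing  = 0
codeLetter m (just b) = suc m ∸ b

scEntry≡codeLetter : ∀ m σ j → scEntry m σ j ≡ codeLetter m (lastM (greaterBefore j σ))
scEntry≡codeLetter m σ j with lastM (greaterBefore j σ)
... | nothing = refl
... | just _  = refl

codeLetter-shift : ∀ k n mb → codeLetter (k + n) (Maybe.map (_+ k) mb) ≡ codeLetter n mb
codeLetter-shift k n nothing  = refl
codeLetter-shift k n (just b) =
  trans (cong₂ _∸_ (sym (+-suc k n)) (+-comm b k)) ([m+n]∸[m+o]≡n∸o k (suc n) b)

greaterBefore-shift : ∀ k t β → greaterBefore (t + k) (map (_+ k) β) ≡ map (_+ k) (greaterBefore t β)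
greaterBefore-shift k t []      = refl
greaterBefore-shift k t (y ∷ β) with <-cmp y t
... | tri< y<t _ _ = trans (greaterBefore-smaller _ (+-monoˡ-< k y<t))
                           (trans (greaterBefore-shift k t β) (cong (map (_+ k)) (sym (greaterBefore-smaller β y<t))))
... | tri≈ _ refl _ = trans (greaterBefore-self (t + k) _) (cong (map (_+ k)) (sym (greaterBefore-self t β)))
... | tri> _ _ t<y = trans (greaterBefore-larger _ (+-monoˡ-< k t<y))
                           (trans (cong (y + k ∷_) (greaterBefore-shift k t β))
                                  (cong (map (_+ k)) (sym (greaterBefore-larger β t<y))))

greaterBefore-∷-cong : ∀ {j} x {σ τ} → greaterBefore j σ ≡ greaterBefore j τ →
                       greaterBefore j (x ∷ σ) ≡ greaterBefore j (x ∷ τ)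
greaterBefore-∷-cong {j} x {σ} {τ} eq with <-cmp x j
... | tri< x<j _ _  = trans (greaterBefore-smaller σ x<j) (trans eq (sym (greaterBefore-smaller τ x<j)))
... | tri≈ _ refl _ = trans (greaterBefore-self x σ) (sym (greaterBefore-self x τ))
... | tri> _ _ j<x  = trans (greaterBefore-larger σ j<x) (trans (cong (x ∷_) eq) (sym (greaterBefore-larger τ j<x)))

greaterBefore-filter : ∀ {k j} → k < j → ∀ σ → greaterBefore j (filter (k <?_) σ) ≡ greaterBefore j σ
greaterBefore-filter k<j [] = refl
greaterBefore-filter {k} {j} k<j (x ∷ σ) with k <? x
... | yes k<x = trans (cong (greaterBefore j) (filter-accept (k <?_) k<x))
                      (greaterBefore-∷-cong x (greaterBefore-filter k<j σ))
... | no k≮x  = trans (cong (greaterBefore j) (filter-reject (k <?_) k≮x))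
                      (trans (greaterBefore-filter k<j σ) (sym (greaterBefore-smaller σ (≤-<-trans (≮⇒≥ k≮x) k<j))))

Sc-length : ∀ {m} σ → length σ ≡ m → Sc σ ≡ map (scEntry m σ) (idWord m)
Sc-length σ refl = refl

scEntry-shift : ∀ k β σ → filter (k <?_) σ ≡ map (_+ k) β → ∀ {t} → 1 ≤ t →
                scEntry (k + length β) σ (t + k) ≡ scEntry (length β) β t
scEntry-shift k β σ large≡β {t} 1≤t = begin
  scEntry m σ (t + k)
    ≡⟨ scEntry≡codeLetter m σ (t + k) ⟩
  codeLetter m (lastM (greaterBefore (t + k) σ))
    ≡⟨ cong (codeLetter m ∘ lastM) (sym (greaterBefore-filter (+-monoˡ-< k 1≤t) σ)) ⟩
  codeLetter m (lastM (greaterBefore (t + k) (filter (k <?_) σ)))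
    ≡⟨ cong (codeLetter m ∘ lastM ∘ greaterBefore (t + k)) large≡β ⟩
  codeLetter m (lastM (greaterBefore (t + k) (map (_+ k) β)))
    ≡⟨ cong (codeLetter m ∘ lastM) (greaterBefore-shift k t β) ⟩
  codeLetter m (lastM (map (_+ k) (greaterBefore t β)))
    ≡⟨ cong (codeLetter m) (lastM-map (_+ k) (greaterBefore t β)) ⟩
  codeLetter m (Maybe.map (_+ k) (lastM (greaterBefore t β)))
    ≡⟨ codeLetter-shift k (length β) (lastM (greaterBefore t β)) ⟩
  codeLetter (length β) (lastM (greaterBefore t β))
    ≡⟨ sym (scEntry≡codeLetter (length β) β t) ⟩
  scEntry (length β) β t
    ∎
  where
  open ≡-Reasoning
  m = k + length β

Sc-split : ∀ k β σ → length σ ≡ k + length β → filter (k <?_) σ ≡ map (_+ k) β →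
           Sc σ ≡ map (codeLetter (k + length β)) (map (salient nothing σ) (idWord k)) ++ Sc β
Sc-split k β σ len large≡β = begin
  Sc σ
    ≡⟨ Sc-length σ len ⟩
  map (scEntry m σ) (idWord (k + n))
    ≡⟨ cong (map (scEntry m σ)) (idWord-+ k n) ⟩
  map (scEntry m σ) (idWord k ++ map (_+ k) (idWord n))
    ≡⟨ map-++ (scEntry m σ) (idWord k) _ ⟩
  map (scEntry m σ) (idWord k) ++ map (scEntry m σ) (map (_+ k) (idWord n))
    ≡⟨ cong₂ _++_ small large ⟩
  map (codeLetter m) (map (salient nothing σ) (idWord k)) ++ Sc β
    ∎
  where
  open ≡-Reasoning
  n = length β
  m = k + n
  small : map (scEntry m σ) (idWord k) ≡ map (codeLetter m) (map (salient nothing σ) (idWord k))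
  small = trans (map-cong (λ j → trans (scEntry≡codeLetter m σ j)
                                       (cong (codeLetter m) (lastM≡lastOr (greaterBefore j σ))))
                          (idWord k))
                (map-∘ (idWord k))
  large : map (scEntry m σ) (map (_+ k) (idWord n)) ≡ Sc β
  large = trans (sym (map-∘ (idWord n)))
                (map-cong-local (All.map (scEntry-shift k β σ large≡β) (idWord-positive n)))

tabulate-at : ∀ β → map (at β ∘ suc) (upFrom 0 (length β)) ≡ β
tabulate-at []      = refl
tabulate-at (x ∷ β) = cong (x ∷_) (begin
  map (at (x ∷ β) ∘ suc) (upFrom 1 (length β))             ≡⟨ cong (map _) (sym (map-suc-upFrom 0 (length β))) ⟩
  map (at (x ∷ β) ∘ suc) (map suc (upFrom 0 (length β)))   ≡⟨ sym (map-∘ (upFrom 0 (length β))) ⟩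
  map (at β ∘ suc) (upFrom 0 (length β))                   ≡⟨ tabulate-at β ⟩
  β                                                        ∎)
  where open ≡-Reasoning

tauS-upFrom : ∀ β → map (tauS β) (upFrom 1 (length β)) ≡ map (suc (length β) ∸_) β
tauS-upFrom β = begin
  map (tauS β) (upFrom 1 n)                        ≡⟨ cong (map (tauS β)) (sym (map-suc-upFrom 0 n)) ⟩
  map (tauS β) (map suc (upFrom 0 n))              ≡⟨ sym (map-∘ (upFrom 0 n)) ⟩
  map ((suc n ∸_) ∘ at β ∘ suc) (upFrom 0 n)       ≡⟨ map-∘ (upFrom 0 n) ⟩
  map (suc n ∸_) (map (at β ∘ suc) (upFrom 0 n))   ≡⟨ cong (map (suc n ∸_)) (tabulate-at β) ⟩
  map (suc n ∸_) β                                 ∎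
  where
  open ≡-Reasoning
  n = length β

codeLetters≡tauS : ∀ k β → map (codeLetter (k + length β)) (nothing ∷ map just (map (_+ k) β)) ≡
                           map (tauS β) (upFrom 0 (suc (length β)))
codeLetters≡tauS k β = cong (0 ∷_) (begin
  map (codeLetter m) (map just (map (_+ k) β))   ≡⟨ sym (map-∘ (map (_+ k) β)) ⟩
  map (codeLetter m ∘ just) (map (_+ k) β)       ≡⟨ sym (map-∘ β) ⟩
  map (codeLetter m ∘ just ∘ (_+ k)) β           ≡⟨ map-cong (codeLetter-shift k n ∘ just) β ⟩
  map (suc n ∸_) β                               ≡⟨ sym (tauS-upFrom β) ⟩
  map (tauS β) (upFrom 1 n)                      ∎)
  where
  open ≡-Reasoning
  n = length β
  m = k + n

Sc-idShuffle : ∀ k β → All (1 ≤_) β →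
               map Sc (idShuffle k β) ≡
               map (λ is → map (tauS β) is ++ Sc β) (multichoose k (upFrom 0 (suc (length β))))
Sc-idShuffle k β β-positive = begin
  map Sc S
    ≡⟨ map-cong-local splits ⟩
  map ((_++ Sc β) ∘ map (codeLetter m) ∘ salients) S
    ≡⟨ trans (map-∘ S) (cong (map (_++ Sc β)) (map-∘ S)) ⟩
  map (_++ Sc β) (map (map (codeLetter m)) (map salients S))
    ≡⟨ cong (map (_++ Sc β) ∘ map (map (codeLetter m))) shuffled ⟩
  map (_++ Sc β) (map (map (codeLetter m)) (multichoose k (nothing ∷ map just ys)))
    ≡⟨ cong (map (_++ Sc β)) (map-multichoose (codeLetter m) k _) ⟩
  map (_++ Sc β) (multichoose k (map (codeLetter m) (nothing ∷ map just ys)))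
    ≡⟨ cong (map (_++ Sc β) ∘ multichoose k) (codeLetters≡tauS k β) ⟩
  map (_++ Sc β) (multichoose k (map (tauS β) U))
    ≡⟨ cong (map (_++ Sc β)) (sym (map-multichoose (tauS β) k U)) ⟩
  map (_++ Sc β) (map (map (tauS β)) (multichoose k U))
    ≡⟨ sym (map-∘ (multichoose k U)) ⟩
  map (λ is → map (tauS β) is ++ Sc β) (multichoose k U)
    ∎
  where
  open ≡-Reasoning
  n = length β
  m = k + n
  U = upFrom 0 (suc n)
  ys = map (_+ k) β
  S = shuffles (idWord k) ys
  salients : List ℕ → List (Maybe ℕ)
  salients σ = map (salient nothing σ) (idWord k)
  ys-large : All (k <_) ys
  ys-large = All.map⁺ (All.map (+-monoˡ-< k) β-positive)
  splits : All (λ σ → Sc σ ≡ map (codeLetter m) (salients σ) ++ Sc β) S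
  splits = All.zipWith (λ {σ} (len , large≡β) → Sc-split k β σ len large≡β)
    ( All.map (λ len → trans len (cong₂ _+_ (length-idWord k) (length-map (_+ k) β)))
              (length-shuffles (idWord k) ys)
    , filter-shuffles (k <?_) (idWord k) ys (All.map ≤⇒≯ (idWord-bounded k)) ys-large )
  shuffled : map salients S ≡ multichoose k (nothing ∷ map just ys)
  shuffled = trans (salients-shuffles nothing (idWord k) ys (idWord-increasing k)
                      (All.map (λ k<y → All.map (λ j≤k → ≤-<-trans j≤k k<y) (idWord-bounded k)) ys-large))
                   (cong (λ c → multichoose c (nothing ∷ map just ys)) (length-idWord k))

reflect-upFrom : ∀ n → map (suc n ∸_) (upFrom 1 n) ≡ map suc (downFrom n)
reflect-upFrom zero    = refl
reflect-upFrom (suc n) = cong (suc n ∷_) (begin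
  map (suc (suc n) ∸_) (upFrom 2 n)              ≡⟨ cong (map (suc (suc n) ∸_)) (sym (map-suc-upFrom 1 n)) ⟩
  map (suc (suc n) ∸_) (map suc (upFrom 1 n))    ≡⟨ sym (map-∘ (upFrom 1 n)) ⟩
  map (suc n ∸_) (upFrom 1 n)                    ≡⟨ reflect-upFrom n ⟩
  map suc (downFrom n)                           ∎)
  where open ≡-Reasoning

tauS-permutes : ∀ β → β ↭ idWord (length β) →
                map (tauS β) (upFrom 0 (suc (length β))) ↭ upFrom 0 (suc (length β))
tauS-permutes β β↭ = prep 0 (begin
  map (tauS β) (upFrom 1 n)        ≡⟨ tauS-upFrom β ⟩
  map (suc n ∸_) β                 ↭⟨ map⁺ (suc n ∸_) β↭ ⟩
  map (suc n ∸_) (idWord n)        ≡⟨ cong (map (suc n ∸_)) (idWord≡upFrom n) ⟩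
  map (suc n ∸_) (upFrom 1 n)      ≡⟨ reflect-upFrom n ⟩
  map suc (downFrom n)             ↭⟨ map⁺ suc (↭-sym (↭-reverse (downFrom n))) ⟩
  map suc (reverse (downFrom n))   ≡⟨ cong (map suc) (reverse-downFrom n) ⟩
  map suc (upTo n)                 ≡⟨⟩
  idWord n                         ≡⟨ idWord≡upFrom n ⟩
  upFrom 1 n                       ∎)
  where
  open PermutationReasoning
  n = length β

module _ {c ℓ} (R : CommutativeSemiring c ℓ) where
  open CommutativeSemiring R
    using (Carrier; _≈_; 0#; 1#; setoid; +-cong; *-cong; +-identityˡ; +-assoc; *-identityˡ; *-assoc;
           zeroˡ; zeroʳ; distribˡ; distribʳ)
    renaming (+-identityʳ to ⊕-identityʳ; _+_ to _⊕_; _*_ to _⊛_; refl to ≈-refl; sym to ≈-sym; trans to ≈-trans)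
  open Solver R using (solve; _:+_; _:*_; _:=_)
  open import Relation.Binary.Reasoning.Setoid setoid

  -- h k vs is the complete homogeneous symmetric polynomial of degree k evaluated at the
  -- entries of vs, split by whether a monomial contains the first variable.
  h : ℕ → List Carrier → Carrier
  h zero    vs       = 1#
  h (suc k) []       = 0#
  h (suc k) (v ∷ vs) = v ⊛ h k (v ∷ vs) ⊕ h (suc k) vs

  h-swap : ∀ k u v vs → h k (u ∷ v ∷ vs) ≈ h k (v ∷ u ∷ vs)
  h-swap zero          u v vs = ≈-refl
  h-swap (suc zero)    u v vs =
    solve 3 (λ a b c → a :+ (b :+ c) := b :+ (a :+ c)) ≈-refl (u ⊛ 1#) (v ⊛ 1#) (h 1 vs)
  h-swap (suc (suc k)) u v vs = begin
    u ⊛ h (suc k) (u ∷ v ∷ vs) ⊕ (v ⊛ B ⊕ C)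
      ≈⟨ +-cong (*-cong ≈-refl (h-swap (suc k) u v vs)) ≈-refl ⟩
    u ⊛ (v ⊛ Y ⊕ A) ⊕ (v ⊛ B ⊕ C)
      ≈⟨ solve 6 (λ u v Y A B C → u :* (v :* Y :+ A) :+ (v :* B :+ C) := v :* (u :* Y :+ B) :+ (u :* A :+ C))
                 ≈-refl u v Y A B C ⟩
    v ⊛ (u ⊛ Y ⊕ B) ⊕ (u ⊛ A ⊕ C)
      ≈⟨ +-cong (*-cong ≈-refl (+-cong (*-cong ≈-refl (≈-sym (h-swap k u v vs))) ≈-refl)) ≈-refl ⟩
    v ⊛ h (suc k) (u ∷ v ∷ vs) ⊕ (u ⊛ A ⊕ C)
      ≈⟨ +-cong (*-cong ≈-refl (h-swap (suc k) u v vs)) ≈-refl ⟩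
    v ⊛ h (suc k) (v ∷ u ∷ vs) ⊕ (u ⊛ A ⊕ C)
      ∎
    where
    Y = h k (v ∷ u ∷ vs)
    A = h (suc k) (u ∷ vs)
    B = h (suc k) (v ∷ vs)
    C = h (suc (suc k)) vs

  h-∷ : ∀ v {vs ws} → (∀ k → h k vs ≈ h k ws) → ∀ k → h k (v ∷ vs) ≈ h k (v ∷ ws)
  h-∷ v vs≈ws zero    = ≈-refl
  h-∷ v vs≈ws (suc k) = +-cong (*-cong ≈-refl (h-∷ v vs≈ws k)) (vs≈ws (suc k))

  h-↭ : ∀ {vs ws} → vs ↭ ws → ∀ k → h k vs ≈ h k ws
  h-↭ Perm.refl          k = ≈-refl
  h-↭ (Perm.prep v p)    k = h-∷ v (h-↭ p) k
  h-↭ (Perm.swap u v p)  k = ≈-trans (h-swap k u v _) (h-∷ v (h-∷ u (h-↭ p)) k)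
  h-↭ (Perm.trans p q)   k = ≈-trans (h-↭ p k) (h-↭ q k)

  sumR-++ : ∀ xs ys → sumR R (xs ++ ys) ≈ sumR R xs ⊕ sumR R ys
  sumR-++ []       ys = ≈-sym (+-identityˡ _)
  sumR-++ (x ∷ xs) ys = ≈-trans (+-cong ≈-refl (sumR-++ xs ys)) (≈-sym (+-assoc _ _ _))

  sumR-*ˡ : ∀ a xs → sumR R (map (a ⊛_) xs) ≈ a ⊛ sumR R xs
  sumR-*ˡ a []       = ≈-sym (zeroʳ a)
  sumR-*ˡ a (x ∷ xs) = ≈-trans (+-cong ≈-refl (sumR-*ˡ a xs)) (≈-sym (distribˡ _ _ _))

  monomial-++ : ∀ x u v → monomial R x (u ++ v) ≈ monomial R x u ⊛ monomial R x v
  monomial-++ x []      v = ≈-sym (*-identityˡ _)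
  monomial-++ x (i ∷ u) v = ≈-trans (*-cong ≈-refl (monomial-++ x u v)) (≈-sym (*-assoc _ _ _))

  sum-monomials-multichoose : ∀ x c is → sumR R (map (monomial R x) (multichoose c is)) ≈ h c (map x is)
  sum-monomials-multichoose x zero    is       = ⊕-identityʳ 1#
  sum-monomials-multichoose x (suc c) []       = ≈-refl
  sum-monomials-multichoose x (suc c) (i ∷ is) = begin
    sumR R (map mono (map (i ∷_) M₁ ++ M₂))
      ≡⟨ cong (sumR R) (map-++ mono (map (i ∷_) M₁) M₂) ⟩
    sumR R (map mono (map (i ∷_) M₁) ++ map mono M₂)
      ≈⟨ sumR-++ (map mono (map (i ∷_) M₁)) (map mono M₂) ⟩
    sumR R (map mono (map (i ∷_) M₁)) ⊕ sumR R (map mono M₂)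
      ≡⟨ cong (λ l → sumR R l ⊕ sumR R (map mono M₂)) (trans (sym (map-∘ M₁)) (map-∘ M₁)) ⟩
    sumR R (map (x i ⊛_) (map mono M₁)) ⊕ sumR R (map mono M₂)
      ≈⟨ +-cong (≈-trans (sumR-*ˡ (x i) (map mono M₁)) (*-cong ≈-refl (sum-monomials-multichoose x c (i ∷ is))))
                (sum-monomials-multichoose x (suc c) is) ⟩
    h (suc c) (map x (i ∷ is))
      ∎
    where
    mono = monomial R x
    M₁ = multichoose c (i ∷ is)
    M₂ = multichoose (suc c) is

  sum-monomials-++ : ∀ x (f : ℕ → ℕ) w iss →
                     sumR R (map (λ is → monomial R x (map f is ++ w)) iss) ≈
                     sumR R (map (monomial R (x ∘ f)) iss) ⊛ monomial R x w
  sum-monomials-++ x f w []         = ≈-sym (zeroˡ _)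
  sum-monomials-++ x f w (is ∷ iss) = begin
    monomial R x (map f is ++ w) ⊕ sumR R (map (λ is → monomial R x (map f is ++ w)) iss)
      ≈⟨ +-cong (monomial-++ x (map f is) w) (sum-monomials-++ x f w iss) ⟩
    monomial R x (map f is) ⊛ M ⊕ S ⊛ M
      ≡⟨ cong (λ a → a ⊛ M ⊕ S ⊛ M) (cong (prodR R) (sym (map-∘ is))) ⟩
    monomial R (x ∘ f) is ⊛ M ⊕ S ⊛ M
      ≈⟨ ≈-sym (distribʳ M _ _) ⟩
    sumR R (map (monomial R (x ∘ f)) (is ∷ iss)) ⊛ M
      ∎
    where
    M = monomial R x w
    S = sumR R (map (monomial R (x ∘ f)) iss)

  hComplete≈h : ∀ k n x → hComplete R k n x ≈ h k (map x (upFrom 0 (suc n)))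
  hComplete≈h k n x = begin
    hComplete R k n x
      ≡⟨ cong (sumR R ∘ map (monomial R x)) (ndSeqs≡multichoose k 0 (suc n) refl) ⟩
    sumR R (map (monomial R x) (multichoose k (upFrom 0 (suc n))))
      ≈⟨ sum-monomials-multichoose x k (upFrom 0 (suc n)) ⟩
    h k (map x (upFrom 0 (suc n)))
      ∎

  sum-Sc-idShuffle : ∀ k β → β ↭ idWord (length β) → ∀ x →
                     sumR R (map (λ σ → monomial R x (Sc σ)) (idShuffle k β)) ≈
                     hComplete R k (length β) x ⊛ monomial R x (Sc β)
  sum-Sc-idShuffle k β β↭ x = begin
    sumR R (map (λ σ → monomial R x (Sc σ)) (idShuffle k β))
      ≡⟨ cong (sumR R) (map-∘ (idShuffle k β)) ⟩
    sumR R (map (monomial R x) (map Sc (idShuffle k β)))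
      ≡⟨ cong (sumR R ∘ map (monomial R x)) (Sc-idShuffle k β (↭idWord-positive β↭)) ⟩
    sumR R (map (monomial R x) (map codeOf (multichoose k U)))
      ≡⟨ cong (sumR R) (sym (map-∘ (multichoose k U))) ⟩
    sumR R (map (monomial R x ∘ codeOf) (multichoose k U))
      ≈⟨ sum-monomials-++ x (tauS β) (Sc β) (multichoose k U) ⟩
    sumR R (map (monomial R (x ∘ tauS β)) (multichoose k U)) ⊛ M
      ≈⟨ *-cong (sum-monomials-multichoose (x ∘ tauS β) k U) ≈-refl ⟩
    h k (map (x ∘ tauS β) U) ⊛ M
      ≡⟨ cong (λ vs → h k vs ⊛ M) (map-∘ U) ⟩
    h k (map x (map (tauS β) U)) ⊛ M
      ≈⟨ *-cong (h-↭ (map⁺ x (tauS-permutes β β↭)) k) ≈-refl ⟩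
    h k (map x U) ⊛ M
      ≈⟨ *-cong (≈-sym (hComplete≈h k n x)) ≈-refl ⟩
    hComplete R k n x ⊛ M
      ∎
    where
    n = length β
    U = upFrom 0 (suc n)
    M = monomial R x (Sc β)
    codeOf : List ℕ → List ℕ
    codeOf is = map (tauS β) is ++ Sc β

mainTheorem10 : {c ℓ : Level} (n k : ℕ) (β : List ℕ) → β ↭ idWord n → 1 ≤ k →
    ((c : List ℕ) →
      (c ∈ map Sc (idShuffle k β) →
        ∃[ is ] (length is ≡ k × Linked _≤_ is × All (_≤ n) is ×
                 c ≡ map (tauS β) is ++ Sc β))
      × ((is : List ℕ) → length is ≡ k → Linked _≤_ is → All (_≤ n) is →
         map (tauS β) is ++ Sc β ∈ map Sc (idShuffle k β)))
    × ((R : CommutativeSemiring c ℓ) (x : ℕ → CommutativeSemiring.Carrier R) →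
       CommutativeSemiring._≈_ R
         (sumR R (map (λ σ → monomial R x (Sc σ)) (idShuffle k β)))
         (CommutativeSemiring._*_ R (hComplete R k n x) (monomial R x (Sc β))))
mainTheorem10 n k β β↭ _ with trans (↭-length β↭) (length-idWord n)
... | refl = (λ _ → codes⁻ , codes⁺) , λ R x → sum-Sc-idShuffle R k β β↭ x
  where
  U = upFrom 0 (suc (length β))
  codes : map Sc (idShuffle k β) ≡ map (λ is → map (tauS β) is ++ Sc β) (multichoose k U)
  codes = Sc-idShuffle k β (↭idWord-positive β↭)
  codes⁻ : ∀ {c} → c ∈ map Sc (idShuffle k β) →
           ∃[ is ] (length is ≡ k × Linked _≤_ is × All (_≤ length β) is × c ≡ map (tauS β) is ++ Sc β)
  codes⁻ c∈ with ∈-map⁻ _ (subst (_ ∈_) codes c∈)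
  ... | is , is∈ , refl with ∈-multichoose-upFrom⁻ k 0 (suc (length β)) refl is∈
  ...   | len , sorted , ≤n , _ = is , len , sorted , ≤n , refl
  codes⁺ : ∀ is → length is ≡ k → Linked _≤_ is → All (_≤ length β) is →
           map (tauS β) is ++ Sc β ∈ map Sc (idShuffle k β)
  codes⁺ is len sorted ≤n = subst (_ ∈_) (sym codes)
    (∈-map⁺ _ (∈-multichoose-upFrom⁺ k 0 (suc (length β)) refl is len sorted ≤n (All.map (λ _ → z≤n) ≤n)))
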